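{- For every nonempty interval-poset $I$ there is exactly one pair $(I_1,I_2)$ of (possibly empty) interval-posets such that $I$ appears in the sum $\mathbb B(I_1,I_2)$.
   Context: An interval-poset of size $n$ is a partial order $\triangleleft$ on $\{1,\dots,n\}$ such that: if $a<c$ and $a\triangleleft c$ then $b\triangleleft c$ for all $a<b<c$; if $a<c$ and $c\triangleleft a$ then $b\triangleleft a$ for all $a<b<c$. For interval-posets $I_1,I_2$ of sizes $k_1,k_2$, the composition $\mathbb B(I_1,I_2)$ is the formal sum of all interval-posets on $\{1,\dots,k_1+k_2+1\}$ such that (i) the relations among $1,\dots,k_1$ are those of $I_1$; (ii) the relations among $k_1+2,\dots,k_1+k_2+1$ are those of $I_2$ shifted by $k_1+1$; (iii) $i\triangleleft k_1+1$ for all $i\le k_1$; (iv) there is no relation $k_1+1\triangleleft j$ with $j>k_1+1$. -}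

module Defs where

open import Data.Nat using (ℕ; suc; _+_)
open import Data.Bool using (Bool; true; false)
open import Data.Fin using (Fin; zero; suc; _<_; cast; _↑ˡ_; _↑ʳ_)
open import Data.Product using (Σ; _×_)
open import Relation.Binary.PropositionalEquality using (_≡_)

-- An interval-poset of size n: a (decidable, Bool-valued) partial order ◁
-- on Fin n (Fin n = {0,…,n-1} stands for {1,…,n}, with the natural order _<_).
record IntervalPoset (n : ℕ) : Set where
  field
    rel     : Fin n → Fin n → Bool
    reflex  : ∀ a → rel a a ≡ true
    antisym : ∀ a b → rel a b ≡ true → rel b a ≡ true → a ≡ b
    trans   : ∀ a b c → rel a b ≡ true → rel b c ≡ true → rel a c ≡ true
    interval₁ : ∀ a b c → a < b → b < c → rel a c ≡ true → rel b c ≡ true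
    interval₂ : ∀ a b c → a < b → b < c → rel c a ≡ true → rel b a ≡ true

open IntervalPoset public

SameIP : ∀ {a b} → IntervalPoset a → IntervalPoset b → Set
SameIP {a} {b} I J =
  Σ (a ≡ b) λ e → ∀ i j → rel I i j ≡ rel J (cast e i) (cast e j)

-- "I appears in the formal sum B(I₁, I₂)", where I has size m and
-- e : k₁ + (k₂ + 1) ≡ m.  Positions (0-based): I₁ occupies 0..k₁-1,
-- the root is k₁, and I₂ is shifted to k₁+1..k₁+k₂.
module _ {k₁ k₂ m : ℕ} (e : k₁ + suc k₂ ≡ m) where
  left : Fin k₁ → Fin m
  left i = cast e (i ↑ˡ suc k₂)

  root : Fin m
  root = cast e (k₁ ↑ʳ zero)

  right : Fin k₂ → Fin m
  right j = cast e (k₁ ↑ʳ suc j)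

AppearsIn : ∀ {k₁ k₂ m} → IntervalPoset m → (e : k₁ + suc k₂ ≡ m) →
            IntervalPoset k₁ → IntervalPoset k₂ → Set
AppearsIn I e I₁ I₂ =
    (∀ i j → rel I (left e i) (left e j) ≡ rel I₁ i j)
  × (∀ i j → rel I (right e i) (right e j) ≡ rel I₂ i j)
  × (∀ i → rel I (left e i) (root e) ≡ true)
  × (∀ j → rel I (root e) (right e j) ≡ false)

-- Call x a root of I if every y < x satisfies y ◁ x and x ◁ y holds for no y > x.
-- In any appearance of I in B(I₁, I₂) the position of the root of B is a root of I,
-- and I has at most one root: for roots x < x′ the root x′ forces x ◁ x′, which the
-- root x forbids.  This pins down the sizes of I₁ and I₂, and then I₁ and I₂ are the
-- restrictions of I to the positions left and right of the root.  Conversely, the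
-- largest x lying above all smaller elements is a root: if x ◁ y with x < y, then
-- every z < y lies below y, by transitivity for z < x and by the interval property
-- for x < z, contradicting the maximality of x.
module Submission where

open import Defs
open import Data.Nat using (ℕ; suc; _+_)
open import Data.Product using (Σ; _×_)
open import Relation.Binary.PropositionalEquality using (_≡_)

open import Data.Nat as ℕ using (_∸_; s≤s)
import Data.Nat.Properties as ℕ
open import Data.Bool using (true; false)
open import Data.Bool.Properties using (¬-not) renaming (_≟_ to _≟ᵇ_)
open import Data.Fin using (Fin; zero; suc; toℕ; cast; splitAt; _<_; _↑ˡ_; _↑ʳ_)
open import Data.Fin.Properties
  using ( toℕ-injective; toℕ-cast; toℕ-↑ˡ; toℕ-↑ʳ; toℕ<n; cast-is-id; cast-involutive
        ; splitAt⁻¹-↑ˡ; splitAt⁻¹-↑ʳ; <-cmp; <-irrefl; <-asym; _<?_; any?; all? )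
open import Data.Product using (∃; _,_)
open import Data.Sum using (inj₁; inj₂)
open import Function using (_∘_)
open import Relation.Binary.Core using (_Preserves_⟶_)
open import Relation.Binary.Definitions using (tri<; tri≈; tri>)
open import Relation.Binary.PropositionalEquality as ≡
  using (refl; sym; cong; cong₂; subst; subst₂)
open import Relation.Nullary using (¬_; yes; no; contradiction)
open import Relation.Nullary.Decidable using (_→-dec_)
open import Relation.Unary using (Pred; Decidable)

module _ {k₁ k₂ m : ℕ} (e : k₁ + suc k₂ ≡ m) where

  toℕ-left : ∀ i → toℕ (left e i) ≡ toℕ i
  toℕ-left i = ≡.trans (toℕ-cast e (i ↑ˡ suc k₂)) (toℕ-↑ˡ i (suc k₂))

  toℕ-root : toℕ (root e) ≡ k₁
  toℕ-root = ≡.trans (toℕ-cast e (k₁ ↑ʳ zero)) (≡.trans (toℕ-↑ʳ k₁ zero) (ℕ.+-identityʳ k₁))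

  toℕ-right : ∀ j → toℕ (right e j) ≡ k₁ + suc (toℕ j)
  toℕ-right j = ≡.trans (toℕ-cast e (k₁ ↑ʳ suc j)) (toℕ-↑ʳ k₁ (suc j))

  left-strictlyMonotone : left e Preserves _<_ ⟶ _<_
  left-strictlyMonotone {i} {j} =
    subst₂ ℕ._<_ (sym (toℕ-left i)) (sym (toℕ-left j))

  right-strictlyMonotone : right e Preserves _<_ ⟶ _<_
  right-strictlyMonotone {i} {j} i<j =
    subst₂ ℕ._<_ (sym (toℕ-right i)) (sym (toℕ-right j)) (ℕ.+-monoʳ-< k₁ (s≤s i<j))

  left<root : ∀ i → left e i < root e
  left<root i = subst₂ ℕ._<_ (sym (toℕ-left i)) (sym toℕ-root) (toℕ<n i)

  root<right : ∀ j → root e < right e j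
  root<right j = subst₂ ℕ._<_ (sym toℕ-root) (sym (toℕ-right j)) (ℕ.m<m+n k₁ ℕ.z<s)

  data Position : Fin m → Set where
    at-left  : ∀ i → Position (left e i)
    at-root  : Position (root e)
    at-right : ∀ j → Position (right e j)

  position : ∀ y → Position y
  position y = subst Position (cast-involutive e (sym e) y) (positionOfCast (cast (sym e) y))
    where
    positionOfCast : ∀ z → Position (cast e z)
    positionOfCast z with splitAt k₁ z in split
    ... | inj₁ i       = subst (Position ∘ cast e) (splitAt⁻¹-↑ˡ split) (at-left i)
    ... | inj₂ zero    = subst (Position ∘ cast e) (splitAt⁻¹-↑ʳ split) at-root
    ... | inj₂ (suc j) = subst (Position ∘ cast e) (splitAt⁻¹-↑ʳ split) (at-right j)

strictlyMonotone⇒injective : ∀ {k m} {f : Fin k → Fin m} → f Preserves _<_ ⟶ _<_ →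
                             ∀ {a b} → f a ≡ f b → a ≡ b
strictlyMonotone⇒injective mono {a} {b} fa≡fb with <-cmp a b
... | tri< a<b _ _ = contradiction (mono a<b) (<-irrefl fa≡fb)
... | tri≈ _ a≡b _ = a≡b
... | tri> _ _ b<a = contradiction (mono b<a) (<-irrefl (sym fa≡fb))

restrict : ∀ {k m} (I : IntervalPoset m) (f : Fin k → Fin m) →
           f Preserves _<_ ⟶ _<_ → IntervalPoset k
restrict I f mono = record
  { rel       = λ a b → rel I (f a) (f b)
  ; reflex    = λ a → reflex I (f a)
  ; antisym   = λ a b p q → strictlyMonotone⇒injective mono (antisym I (f a) (f b) p q)
  ; trans     = λ a b c → trans I (f a) (f b) (f c)
  ; interval₁ = λ a b c a<b b<c → interval₁ I (f a) (f b) (f c) (mono a<b) (mono b<c)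
  ; interval₂ = λ a b c a<b b<c → interval₂ I (f a) (f b) (f c) (mono a<b) (mono b<c)
  }

sameIP-of-≗ : ∀ {k} (I J : IntervalPoset k) → (∀ i j → rel I i j ≡ rel J i j) → SameIP I J
sameIP-of-≗ _ J I≗J =
  refl , λ i j → ≡.trans (I≗J i j) (sym (cong₂ (rel J) (cast-is-id refl i) (cast-is-id refl j)))

module _ {m : ℕ} (I : IntervalPoset m) where

  AllBelow : Fin m → Set
  AllBelow x = ∀ y → y < x → rel I y x ≡ true

  IsRoot : Fin m → Set
  IsRoot x = AllBelow x × (∀ y → x < y → rel I x y ≡ false)

  allBelow? : Decidable AllBelow
  allBelow? x = all? λ y → y <? x →-dec rel I y x ≟ᵇ true

  allBelow-extend : ∀ {x y} → AllBelow x → x < y → rel I x y ≡ true → AllBelow y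
  allBelow-extend {x} {y} below-x x<y x◁y z z<y with <-cmp z x
  ... | tri< z<x _ _ = trans I z x y (below-x z z<x) x◁y
  ... | tri≈ _ refl _ = x◁y
  ... | tri> _ _ x<z = interval₁ I x z y x<z z<y x◁y

  isRoot-unique : ∀ {x x′} → IsRoot x → IsRoot x′ → x ≡ x′
  isRoot-unique {x} {x′} (below , notAbove) (below′ , notAbove′) with <-cmp x x′
  ... | tri< x<x′ _ _ = contradiction (≡.trans (sym (below′ x x<x′)) (notAbove x′ x<x′)) λ ()
  ... | tri≈ _ x≡x′ _ = x≡x′
  ... | tri> _ _ x′<x = contradiction (≡.trans (sym (below x′ x′<x)) (notAbove′ x x′<x)) λ ()

largest : ∀ {n p} {P : Pred (Fin n) p} → Decidable P → ∃ P →
          Σ (Fin n) λ r → P r × (∀ y → r < y → ¬ P y)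
largest {suc n} P? _ with any? (P? ∘ suc)
... | yes ∃P∘suc with largest (P? ∘ suc) ∃P∘suc
...   | r , Pr , maximal = suc r , Pr , λ { (suc y) (s≤s r<y) → maximal y r<y }
largest {suc n} P? (zero , P0) | no ¬∃P∘suc =
  zero , P0 , λ { (suc y) _ Py → ¬∃P∘suc (y , Py) }
largest {suc n} P? (suc x , Px) | no ¬∃P∘suc = contradiction (x , Px) ¬∃P∘suc

isRoot-exists : ∀ {n} (I : IntervalPoset (suc n)) → Σ (Fin (suc n)) (IsRoot I)
isRoot-exists I with largest (allBelow? I) (zero , λ _ ())
... | r , below-r , maximal =
  r , below-r , λ y r<y → ¬-not λ r◁y → maximal y r<y (allBelow-extend I below-r r<y r◁y)

module _ {k₁ k₂ m : ℕ} (I : IntervalPoset m) (e : k₁ + suc k₂ ≡ m) where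

  leftFactor : IntervalPoset k₁
  leftFactor = restrict I (left e) (left-strictlyMonotone e)

  rightFactor : IntervalPoset k₂
  rightFactor = restrict I (right e) (right-strictlyMonotone e)

  isRoot⇒appearsIn : IsRoot I (root e) → AppearsIn I e leftFactor rightFactor
  isRoot⇒appearsIn (below , notAbove) =
    (λ _ _ → refl) , (λ _ _ → refl) ,
    (λ i → below (left e i) (left<root e i)) , (λ j → notAbove (right e j) (root<right e j))

  appearsIn⇒isRoot : ∀ I₁ I₂ → AppearsIn I e I₁ I₂ → IsRoot I (root e)
  appearsIn⇒isRoot _ _ (_ , _ , left◁root , root⋪right) = below , notAbove
    where
    below : AllBelow I (root e)
    below y y<root with position e y
    ... | at-left i  = left◁root i
    ... | at-root    = contradiction y<root (<-irrefl refl)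
    ... | at-right j = contradiction (root<right e j) (<-asym y<root)

    notAbove : ∀ y → root e < y → rel I (root e) y ≡ false
    notAbove y root<y with position e y
    ... | at-left i  = contradiction (left<root e i) (<-asym root<y)
    ... | at-root    = contradiction root<y (<-irrefl refl)
    ... | at-right j = root⋪right j

appearsIn-rootSize-unique :
  ∀ {k₁ k₂ l₁ l₂ m} (I : IntervalPoset m)
    (e : k₁ + suc k₂ ≡ m) I₁ I₂ (e′ : l₁ + suc l₂ ≡ m) J₁ J₂ →
    AppearsIn I e I₁ I₂ → AppearsIn I e′ J₁ J₂ → k₁ ≡ l₁
appearsIn-rootSize-unique I e I₁ I₂ e′ J₁ J₂ ap ap′ = begin
  _               ≡⟨ sym (toℕ-root e) ⟩
  toℕ (root e)    ≡⟨ cong toℕ (isRoot-unique I (appearsIn⇒isRoot I e I₁ I₂ ap)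
                                               (appearsIn⇒isRoot I e′ J₁ J₂ ap′)) ⟩
  toℕ (root e′)   ≡⟨ toℕ-root e′ ⟩
  _               ∎
  where open ≡.≡-Reasoning

-- Once the sizes agree, left e and left e′ coincide definitionally: cast ignores its proof.
appearsIn-unique :
  ∀ {k₁ k₂ l₁ l₂ m} (I : IntervalPoset m)
    (e : k₁ + suc k₂ ≡ m) I₁ I₂ (e′ : l₁ + suc l₂ ≡ m) J₁ J₂ →
    AppearsIn I e I₁ I₂ → AppearsIn I e′ J₁ J₂ → SameIP I₁ J₁ × SameIP I₂ J₂
appearsIn-unique {k₁} I e I₁ I₂ e′ J₁ J₂ ap ap′
  with appearsIn-rootSize-unique I e I₁ I₂ e′ J₁ J₂ ap ap′
... | refl with ℕ.suc-injective (ℕ.+-cancelˡ-≡ k₁ _ _ (≡.trans e (sym e′)))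
...   | refl with ap | ap′
...     | left≗ , right≗ , _ | left≗′ , right≗′ , _ =
  sameIP-of-≗ I₁ J₁ (λ i j → ≡.trans (sym (left≗ i j)) (left≗′ i j)) ,
  sameIP-of-≗ I₂ J₂ (λ i j → ≡.trans (sym (right≗ i j)) (right≗′ i j))

around : ∀ {n} (r : Fin (suc n)) → toℕ r + suc (n ∸ toℕ r) ≡ suc n
around {n} r = ≡.trans (ℕ.+-suc (toℕ r) _) (cong suc (ℕ.m+[n∸m]≡n (ℕ.≤-pred (toℕ<n r))))

root-around : ∀ {n} (r : Fin (suc n)) → root (around r) ≡ r
root-around r = toℕ-injective (toℕ-root (around r))

proposition7p2p7 : ∀ (n : ℕ) (I : IntervalPoset (suc n)) →
    Σ ℕ (λ k₁ → Σ ℕ λ k₂ → Σ (k₁ + suc k₂ ≡ suc n) λ e →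
      Σ (IntervalPoset k₁) λ I₁ → Σ (IntervalPoset k₂) λ I₂ →
        AppearsIn I e I₁ I₂
        × (∀ (l₁ l₂ : ℕ) (e′ : l₁ + suc l₂ ≡ suc n)
             (J₁ : IntervalPoset l₁) (J₂ : IntervalPoset l₂) →
             AppearsIn I e′ J₁ J₂ → SameIP I₁ J₁ × SameIP I₂ J₂))
proposition7p2p7 n I with isRoot-exists I
... | r , r-isRoot =
  toℕ r , n ∸ toℕ r , e , leftFactor I e , rightFactor I e , appears ,
  λ _ _ e′ J₁ J₂ → appearsIn-unique I e (leftFactor I e) (rightFactor I e) e′ J₁ J₂ appears
  where
  e : toℕ r + suc (n ∸ toℕ r) ≡ suc n
  e = around r

  appears : AppearsIn I e (leftFactor I e) (rightFactor I e)
  appears = isRoot⇒appearsIn I e (subst (IsRoot I) (sym (root-around r)) r-isRoot)
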